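{- Define the homogeneous polynomials $f(i,j)=i^3+2i^2j+2ij^2+j^3$ and $g(i,j)=i^3-2i^2j+2ij^2-j^3$. Consider, for a doubly indexed family of numbers $(u_{i,j})_{i,j\ge 0}$, the system of equations $$f(i,0)\,u_{i,j}=f(i,j)\,u_{i-1,j}+g(0,j)\,u_{i-1,j-1},\qquad f(i,0)\,u_{i,j-1}=f(0,j)\,u_{i-1,j}+g(i,j)\,u_{i-1,j-1},$$ required to hold for all integers $i,j\ge 1$. Then this system has a rational-valued solution $(u_{i,j})_{i,j\ge0}$ satisfying each of the following boundary conditions: (a) $u_{0,j}=1$ and $u_{i,0}=1$ for all $i,j\ge 0$; (b) $u_{0,0}=0$, and for all $i,j\ge 1$, $u_{0,j}=\sum_{n=1}^{j} n^{ -3}$ and $u_{i,0}=\sum_{n=1}^{i} n^{ -3}$. -}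

module Defs where

open import Data.Nat as ℕ using (ℕ; zero; suc)
open import Data.Integer using (+_)
open import Data.Rational using (ℚ; _+_; _*_; _-_; _/_; 0ℚ)
open import Relation.Binary.PropositionalEquality using (_≡_)
open import Data.Product using (_×_)

ι : ℕ → ℚ
ι n = + n / 1

f : ℕ → ℕ → ℚ
f i j = let x = ι i ; y = ι j in
  x * x * x + ι 2 * x * x * y + ι 2 * x * y * y + y * y * y

g : ℕ → ℕ → ℚ
g i j = let x = ι i ; y = ι j in
  x * x * x - ι 2 * x * x * y + ι 2 * x * y * y - y * y * y

Solves : (ℕ → ℕ → ℚ) → Set
Solves u = ∀ i' j' → let i = suc i' ; j = suc j' in
    (f i 0 * u i j ≡ f i j * u i' j + g 0 j * u i' j')
  × (f i 0 * u i j' ≡ f 0 j * u i' j + g i j * u i' j')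

H3 : ℕ → ℚ
H3 zero = 0ℚ
H3 (suc n) = H3 n + (+ 1 / (suc n ℕ.* suc n ℕ.* suc n))

BoundaryA : (ℕ → ℕ → ℚ) → Set
BoundaryA u = (∀ j → u 0 j ≡ ι 1) × (∀ i → u i 0 ≡ ι 1)

BoundaryB : (ℕ → ℕ → ℚ) → Set
BoundaryB u = (u 0 0 ≡ 0ℚ)
  × (∀ j → u 0 (suc j) ≡ H3 (suc j))
  × (∀ i → u (suc i) 0 ≡ H3 (suc i))

{-# OPTIONS --safe #-}
module Submission where

open import Defs
open import Data.Rational using (ℚ)
open import Data.Nat using (ℕ)
open import Data.Product using (_×_; ∃)

open import Level using (0ℓ)
open import Algebra.Bundles.Raw using (RawRing)
open import Data.Nat as ℕ using (zero; suc)
open import Data.Integer as ℤ using (+_)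
import Data.Integer.Properties as ℤ
import Data.Integer.Tactic.RingSolver as ℤ-Solver
import Data.Rational as Rational
open Rational using (0ℚ; 1ℚ; _/_; toℚᵘ)
open import Data.Rational.Properties
  using (toℚᵘ-injective; toℚᵘ-fromℚᵘ; toℚᵘ-homo-+; toℚᵘ-homo-*; +-inverseʳ; +-0-abelianGroup;
         *-comm; *-assoc; *-identityˡ; *-zeroʳ)
open import Algebra.Properties.AbelianGroup +-0-abelianGroup using (xyx⁻¹≈y; x∙y⁻¹≈ε⇒x≈y; x≈y⇒x∙y⁻¹≈ε)
open import Data.Rational.Unnormalised as ℚᵘ using (mkℚᵘ; *≡*)
import Data.Rational.Unnormalised.Properties as ℚᵘ
open import Data.Rational.Solver using (module +-*-Solver)
open +-*-Solver using (solve; _:=_; con; _:+_; _:*_; :-_; _:-_; Polynomial)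
open import Data.Product using (_,_)
open import Relation.Binary.PropositionalEquality

-- Solve the first equation for u(i,j), i, j ≥ 1, which is possible because f(i,0) = i³ ≠ 0,
-- and put u(0,n) = u(n,0) = w(n). The second equation then follows by induction on i. In the
-- interior, a polynomial identity expresses i³ times its defect at (i+1, j+1) through the
-- defects of both equations at (i, j) and (i, j+1). Where i = 1 or j = 1 the same computation
-- leaves the extra term (n+1)³ (w(n+1) − w(n)) − n³ (w(n) − w(n−1)), which vanishes as soon as
-- n³ (w(n) − w(n−1)) does not depend on n: it is 0 for w = 1 and 1 for w(n) = Σ_{k ≤ n} k⁻³.

-- Polynomial expressions over an arbitrary raw ring, so that the ring solver's syntax
-- (polynomialRawRing below) reuses the very same definitions; over ℚ, F and G are f and g.
module Polynomials (R : RawRing 0ℓ 0ℓ) where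
  open RawRing R

  private
    infixl 6 _-_
    _-_ : Carrier → Carrier → Carrier
    x - y = x + - y

    two : Carrier
    two = 1# + 1#

  F G : Carrier → Carrier → Carrier
  F x y = x * x * x + two * x * x * y + two * x * y * y + y * y * y
  G x y = x * x * x - two * x * x * y + two * x * y * y - y * y * y

  cube : Carrier → Carrier
  cube x = x * x * x

  -- Right-hand side minus left-hand side of the two equations at (i, j) = (x, y), where
  -- a₀ = u(i−1,j−1), a₁ = u(i−1,j), b₀ = u(i,j−1) and b₁ = u(i,j).
  firstDefect secondDefect : Carrier → Carrier → Carrier → Carrier → Carrier → Carrier
  firstDefect x y a₀ a₁ b₁ = F x y * a₁ + G 0# y * a₀ - F x 0# * b₁
  secondDefect x y a₀ a₁ b₀ = F 0# y * a₁ + G x y * a₀ - F x 0# * b₀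

  cubicDefect : Carrier → Carrier → Carrier → Carrier → Carrier → Carrier
  cubicDefect x x′ w₀ w₁ w₂ = cube x′ * (w₂ - w₁) - cube x * (w₁ - w₀)

polynomialRawRing : ℕ → RawRing 0ℓ 0ℓ
polynomialRawRing n = record
  { Carrier = Polynomial n ; _≈_ = _≡_ ; _+_ = _:+_ ; _*_ = _:*_ ; -_ = :-_ ; 0# = con 0ℚ ; 1# = con 1ℚ }

open Polynomials Rational.+-*-rawRing
module Syntax {n : ℕ} = Polynomials (polynomialRawRing n)

-- Imported only here because Polynomials defines its own _-_.
open Rational using (_+_; _*_; _-_)

toℚᵘ-ι : ∀ n → toℚᵘ (ι n) ℚᵘ.≃ mkℚᵘ (+ n) 0
toℚᵘ-ι n = toℚᵘ-fromℚᵘ (mkℚᵘ (+ n) 0)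

ι-+ : ∀ m n → ι (m ℕ.+ n) ≡ ι m + ι n
ι-+ m n = toℚᵘ-injective (begin
  toℚᵘ (ι (m ℕ.+ n))              ≈⟨ toℚᵘ-ι (m ℕ.+ n) ⟩
  mkℚᵘ (+ (m ℕ.+ n)) 0             ≈⟨ *≡* (trans (cong (ℤ._* (+ 1 ℤ.* + 1)) (ℤ.pos-+ m n)) (over-one (+ m) (+ n))) ⟩
  mkℚᵘ (+ m) 0 ℚᵘ.+ mkℚᵘ (+ n) 0   ≈⟨ ℚᵘ.+-cong (toℚᵘ-ι m) (toℚᵘ-ι n) ⟨
  toℚᵘ (ι m) ℚᵘ.+ toℚᵘ (ι n)       ≈⟨ toℚᵘ-homo-+ (ι m) (ι n) ⟨
  toℚᵘ (ι m + ι n)                 ∎)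
  where
  open ℚᵘ.≃-Reasoning
  over-one : ∀ a b → (a ℤ.+ b) ℤ.* (+ 1 ℤ.* + 1) ≡ (a ℤ.* + 1 ℤ.+ b ℤ.* + 1) ℤ.* + 1
  over-one = ℤ-Solver.solve-∀

ι-* : ∀ m n → ι (m ℕ.* n) ≡ ι m * ι n
ι-* m n = toℚᵘ-injective (begin
  toℚᵘ (ι (m ℕ.* n))              ≈⟨ toℚᵘ-ι (m ℕ.* n) ⟩
  mkℚᵘ (+ (m ℕ.* n)) 0             ≈⟨ *≡* (trans (cong (ℤ._* (+ 1 ℤ.* + 1)) (ℤ.pos-* m n)) (over-one (+ m) (+ n))) ⟩
  mkℚᵘ (+ m) 0 ℚᵘ.* mkℚᵘ (+ n) 0   ≈⟨ ℚᵘ.*-cong (toℚᵘ-ι m) (toℚᵘ-ι n) ⟨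
  toℚᵘ (ι m) ℚᵘ.* toℚᵘ (ι n)       ≈⟨ toℚᵘ-homo-* (ι m) (ι n) ⟨
  toℚᵘ (ι m * ι n)                 ∎)
  where
  open ℚᵘ.≃-Reasoning
  over-one : ∀ a b → (a ℤ.* b) ℤ.* (+ 1 ℤ.* + 1) ≡ (a ℤ.* b) ℤ.* + 1
  over-one = ℤ-Solver.solve-∀

ι-*-1/ : ∀ n .{{_ : ℕ.NonZero n}} → ι n * (+ 1 / n) ≡ 1ℚ
ι-*-1/ n@(suc k) = toℚᵘ-injective (begin
  toℚᵘ (ι n * (+ 1 / n))           ≈⟨ toℚᵘ-homo-* (ι n) (+ 1 / n) ⟩
  toℚᵘ (ι n) ℚᵘ.* toℚᵘ (+ 1 / n)   ≈⟨ ℚᵘ.*-cong (toℚᵘ-ι n) (toℚᵘ-fromℚᵘ (mkℚᵘ (+ 1) k)) ⟩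
  mkℚᵘ (+ n) 0 ℚᵘ.* mkℚᵘ (+ 1) k   ≈⟨ *≡* (cancel (+ n)) ⟩
  ℚᵘ.1ℚᵘ                            ∎)
  where
  open ℚᵘ.≃-Reasoning
  cancel : ∀ a → (a ℤ.* + 1) ℤ.* + 1 ≡ + 1 ℤ.* (+ 1 ℤ.* a)
  cancel = ℤ-Solver.solve-∀

ι-suc : ∀ n → ι (suc n) ≡ 1ℚ + ι n
ι-suc = ι-+ 1

p*q≡1⇒p*[r*q]≡r : ∀ {p q} → p * q ≡ 1ℚ → ∀ r → p * (r * q) ≡ r
p*q≡1⇒p*[r*q]≡r {p} {q} pq≡1 r = begin
  p * (r * q)  ≡⟨ cong (p *_) (*-comm r q) ⟩
  p * (q * r)  ≡⟨ *-assoc p q r ⟨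
  p * q * r    ≡⟨ cong (_* r) pq≡1 ⟩
  1ℚ * r       ≡⟨ *-identityˡ r ⟩
  r            ∎
  where open ≡-Reasoning

p*q≡1⇒p*r≡0⇒r≡0 : ∀ {p q r} → p * q ≡ 1ℚ → p * r ≡ 0ℚ → r ≡ 0ℚ
p*q≡1⇒p*r≡0⇒r≡0 {p} {q} {r} pq≡1 pr≡0 = begin
  r            ≡⟨ p*q≡1⇒p*[r*q]≡r {p} {q} pq≡1 r ⟨
  p * (r * q)  ≡⟨ *-assoc p r q ⟨
  p * r * q    ≡⟨ cong (_* q) pr≡0 ⟩
  0ℚ * q       ≡⟨ *-comm 0ℚ q ⟩
  q * 0ℚ       ≡⟨ *-zeroʳ q ⟩
  0ℚ           ∎
  where open ≡-Reasoning

≡0⇒*≡0 : ∀ p {q} → q ≡ 0ℚ → p * q ≡ 0ℚ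
≡0⇒*≡0 p refl = *-zeroʳ p

cube⁻¹ : (n : ℕ) .{{_ : ℕ.NonZero n}} → ℚ
cube⁻¹ n@(suc _) = + 1 / (n ℕ.* n ℕ.* n)

cube-ι*cube⁻¹≡1 : ∀ n .{{_ : ℕ.NonZero n}} → cube (ι n) * cube⁻¹ n ≡ 1ℚ
cube-ι*cube⁻¹≡1 n@(suc _) = begin
  cube (ι n) * cube⁻¹ n       ≡⟨ cong (λ c → c * cube⁻¹ n) ι-cube ⟨
  ι (n ℕ.* n ℕ.* n) * cube⁻¹ n ≡⟨ ι-*-1/ (n ℕ.* n ℕ.* n) ⟩
  1ℚ                           ∎
  where
  open ≡-Reasoning
  ι-cube : ι (n ℕ.* n ℕ.* n) ≡ cube (ι n)
  ι-cube = trans (ι-* (n ℕ.* n) n) (cong (_* ι n) (ι-* n n))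

F[x,0]≡cube : ∀ x → F x 0ℚ ≡ cube x
F[x,0]≡cube = solve 1 (λ x → Syntax.F x (con 0ℚ) := Syntax.cube x) refl

f[n,0]*cube⁻¹≡1 : ∀ n .{{_ : ℕ.NonZero n}} → f n 0 * cube⁻¹ n ≡ 1ℚ
f[n,0]*cube⁻¹≡1 n = trans (cong (_* cube⁻¹ n) (F[x,0]≡cube (ι n))) (cube-ι*cube⁻¹≡1 n)

secondDefect-corner : ∀ w₀ w₁ → secondDefect 1ℚ 1ℚ w₀ w₁ w₁ ≡ 0ℚ
secondDefect-corner = solve 2 (λ w₀ w₁ → Syntax.secondDefect (con 1ℚ) (con 1ℚ) w₀ w₁ w₁ := con 0ℚ) refl

secondDefect-row : ∀ y {y′} → y′ ≡ 1ℚ + y → ∀ a₀ a₁ a₂ b →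
  secondDefect 1ℚ y′ a₁ a₂ b ≡ firstDefect 1ℚ y a₀ a₁ b + cubicDefect y y′ a₀ a₁ a₂
secondDefect-row y refl = solve 5 (λ y a₀ a₁ a₂ b → let y′ = con 1ℚ :+ y in
  Syntax.secondDefect (con 1ℚ) y′ a₁ a₂ b := Syntax.firstDefect (con 1ℚ) y a₀ a₁ b :+ Syntax.cubicDefect y y′ a₀ a₁ a₂)
  refl y

secondDefect-column : ∀ x {x′} → x′ ≡ 1ℚ + x → ∀ w₀ w₁ w₂ a₁ b₁ →
  F x 0ℚ * secondDefect x′ 1ℚ w₁ b₁ w₂ ≡
  F x 1ℚ * secondDefect x 1ℚ w₀ a₁ w₁ - F x 0ℚ * cubicDefect x x′ w₀ w₁ w₂ - firstDefect x 1ℚ w₀ a₁ b₁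
secondDefect-column x refl = solve 6 (λ x w₀ w₁ w₂ a₁ b₁ → let x′ = con 1ℚ :+ x ; O = con 0ℚ ; I = con 1ℚ in
  Syntax.F x O :* Syntax.secondDefect x′ I w₁ b₁ w₂ :=
  Syntax.F x I :* Syntax.secondDefect x I w₀ a₁ w₁ :- Syntax.F x O :* Syntax.cubicDefect x x′ w₀ w₁ w₂ :- Syntax.firstDefect x I w₀ a₁ b₁)
  refl x

secondDefect-interior : ∀ x y {x′ y′} → x′ ≡ 1ℚ + x → y′ ≡ 1ℚ + y → ∀ a₀ a₁ a₂ b₀ b₁ b₂ c₁ →
  F x 0ℚ * secondDefect x′ y′ b₁ b₂ c₁ ≡
  F x y′ * secondDefect x y′ a₁ a₂ b₁ - F 0ℚ y * secondDefect x y a₀ a₁ b₀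
  + F x 0ℚ * firstDefect x′ y b₀ b₁ c₁ - G x y * firstDefect x y a₀ a₁ b₁ - F 0ℚ y′ * firstDefect x y′ a₁ a₂ b₂
secondDefect-interior x y refl refl = solve 9 (λ x y a₀ a₁ a₂ b₀ b₁ b₂ c₁ →
  let x′ = con 1ℚ :+ x ; y′ = con 1ℚ :+ y ; O = con 0ℚ in
  Syntax.F x O :* Syntax.secondDefect x′ y′ b₁ b₂ c₁ :=
  Syntax.F x y′ :* Syntax.secondDefect x y′ a₁ a₂ b₁ :- Syntax.F O y :* Syntax.secondDefect x y a₀ a₁ b₀
  :+ Syntax.F x O :* Syntax.firstDefect x′ y b₀ b₁ c₁ :- Syntax.G x y :* Syntax.firstDefect x y a₀ a₁ b₁
  :- Syntax.F O y′ :* Syntax.firstDefect x y′ a₁ a₂ b₂)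
  refl x y

module Solution (w : ℕ → ℚ) (c : ℚ) (increment : ∀ n → cube (ι (suc n)) * (w (suc n) - w n) ≡ c) where

  u : ℕ → ℕ → ℚ
  u zero    j       = w j
  u (suc i) zero    = w (suc i)
  u (suc i) (suc j) = (f (suc i) (suc j) * u i (suc j) + g 0 (suc j) * u i j) * cube⁻¹ (suc i)

  u[i,0]≡w[i] : ∀ i → u i 0 ≡ w i
  u[i,0]≡w[i] zero    = refl
  u[i,0]≡w[i] (suc i) = refl

  firstDefectAt secondDefectAt : ℕ → ℕ → ℚ
  firstDefectAt i j = firstDefect (ι (suc i)) (ι (suc j)) (u i j) (u i (suc j)) (u (suc i) (suc j))
  secondDefectAt i j = secondDefect (ι (suc i)) (ι (suc j)) (u i j) (u i (suc j)) (u (suc i) j)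

  first-equation : ∀ i j → f (suc i) 0 * u (suc i) (suc j) ≡ f (suc i) (suc j) * u i (suc j) + g 0 (suc j) * u i j
  first-equation i j = p*q≡1⇒p*[r*q]≡r {f (suc i) 0} (f[n,0]*cube⁻¹≡1 (suc i)) _

  firstDefectAt≡0 : ∀ i j → firstDefectAt i j ≡ 0ℚ
  firstDefectAt≡0 i j = x≈y⇒x∙y⁻¹≈ε (sym (first-equation i j))

  recurrence : ∀ n → cubicDefect (ι (suc n)) (ι (suc (suc n))) (w n) (w (suc n)) (w (suc (suc n))) ≡ 0ℚ
  recurrence n = x≈y⇒x∙y⁻¹≈ε (trans (increment (suc n)) (sym (increment n)))

  secondDefectAt≡0 : ∀ i j → secondDefectAt i j ≡ 0ℚ
  secondDefectAt≡0 zero zero = secondDefect-corner (w 0) (w 1)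
  secondDefectAt≡0 zero (suc j) = begin
    secondDefectAt 0 (suc j)
      ≡⟨ secondDefect-row (ι (suc j)) (ι-suc (suc j)) (w j) (w (suc j)) (w (suc (suc j))) (u 1 (suc j)) ⟩
    firstDefectAt 0 j + cubicDefect (ι (suc j)) (ι (suc (suc j))) (w j) (w (suc j)) (w (suc (suc j)))
      ≡⟨ cong₂ _+_ (firstDefectAt≡0 0 j) (recurrence j) ⟩
    -- 0ℚ + 0ℚ, like any closed rational expression, computes to 0ℚ
    0ℚ ∎
    where open ≡-Reasoning
  secondDefectAt≡0 (suc i) zero = p*q≡1⇒p*r≡0⇒r≡0 {f (suc i) 0} (f[n,0]*cube⁻¹≡1 (suc i)) (begin
    F x 0ℚ * secondDefectAt (suc i) 0
      ≡⟨ secondDefect-column x (ι-suc (suc i)) (u i 0) (w (suc i)) (w (suc (suc i))) (u i 1) (u (suc i) 1) ⟩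
    F x 1ℚ * secondDefectAt i 0 - F x 0ℚ * cubicDefect x (ι (suc (suc i))) (u i 0) (w (suc i)) (w (suc (suc i)))
      - firstDefectAt i 0
      ≡⟨ cong₂ _-_ (cong₂ _-_ (≡0⇒*≡0 (F x 1ℚ) (secondDefectAt≡0 i 0)) (≡0⇒*≡0 (F x 0ℚ) column-recurrence))
                   (firstDefectAt≡0 i 0) ⟩
    0ℚ ∎)
    where
    open ≡-Reasoning
    x = ι (suc i)
    column-recurrence : cubicDefect x (ι (suc (suc i))) (u i 0) (w (suc i)) (w (suc (suc i))) ≡ 0ℚ
    column-recurrence rewrite u[i,0]≡w[i] i = recurrence i
  secondDefectAt≡0 (suc i) (suc j) = p*q≡1⇒p*r≡0⇒r≡0 {f (suc i) 0} (f[n,0]*cube⁻¹≡1 (suc i)) (begin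
    F x 0ℚ * secondDefectAt (suc i) (suc j)
      ≡⟨ secondDefect-interior x y (ι-suc (suc i)) (ι-suc (suc j))
           (u i j) (u i (suc j)) (u i (suc (suc j))) (u (suc i) j) (u (suc i) (suc j)) (u (suc i) (suc (suc j)))
           (u (suc (suc i)) (suc j)) ⟩
    F x y′ * secondDefectAt i (suc j) - F 0ℚ y * secondDefectAt i j
      + F x 0ℚ * firstDefectAt (suc i) j - G x y * firstDefectAt i j - F 0ℚ y′ * firstDefectAt i (suc j)
      ≡⟨ cong₂ _-_ (cong₂ _-_ (cong₂ _+_ (cong₂ _-_ (≡0⇒*≡0 (F x y′) (secondDefectAt≡0 i (suc j)))
                                                   (≡0⇒*≡0 (F 0ℚ y) (secondDefectAt≡0 i j)))
                                        (≡0⇒*≡0 (F x 0ℚ) (firstDefectAt≡0 (suc i) j)))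
                             (≡0⇒*≡0 (G x y) (firstDefectAt≡0 i j)))
                   (≡0⇒*≡0 (F 0ℚ y′) (firstDefectAt≡0 i (suc j))) ⟩
    0ℚ ∎)
    where
    open ≡-Reasoning
    x = ι (suc i)
    y = ι (suc j)
    y′ = ι (suc (suc j))

  solves : Solves u
  solves i j = first-equation i j , sym (x∙y⁻¹≈ε⇒x≈y _ _ (secondDefectAt≡0 i j))

module Constant = Solution (λ _ → ι 1) 0ℚ (λ n → ≡0⇒*≡0 (cube (ι (suc n))) (+-inverseʳ (ι 1)))

module Harmonic = Solution H3 1ℚ (λ n → trans (cong (cube (ι (suc n)) *_) (xyx⁻¹≈y (H3 n) (cube⁻¹ (suc n))))
                                              (cube-ι*cube⁻¹≡1 (suc n)))

proposition1 : (∃ λ (u : ℕ → ℕ → ℚ) → Solves u × BoundaryA u)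
             × (∃ λ (u : ℕ → ℕ → ℚ) → Solves u × BoundaryB u)
proposition1 =
  (Constant.u , Constant.solves , (λ _ → refl) , Constant.u[i,0]≡w[i]) ,
  (Harmonic.u , Harmonic.solves , refl , (λ _ → refl) , (λ _ → refl))
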